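{- Let $k\ge1$ and let $S\subseteq\mathbb{Z}^k$ be such that $\mathbb{Z}^k\setminus S$ is finite. Then there exist $n\ge0$ and a $k$-tuple $f\in(\mathbb{Z}[x_1,\ldots,x_n])^k$ of polynomials with integer coefficients such that $f(\mathbb{Z}^n)=S$.
   Context: $f(\mathbb{Z}^n)$ denotes the image of the map $\mathbb{Z}^n\to\mathbb{Z}^k$ obtained by substituting integers for the variables. -}

module Defs where

open import Data.Nat using (ℕ)
open import Data.Integer using (ℤ; _+_; _*_)
open import Data.Fin using (Fin)
open import Data.Vec using (Vec; lookup; map)

-- Polynomials with integer coefficients in the variables x_0,...,x_{n-1},
-- represented as formal expressions (every element of ℤ[x_1..x_n] is one,
-- and negation is  con -1 ⊗ p).
data Poly (n : ℕ) : Set where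
  con  : ℤ → Poly n
  var  : Fin n → Poly n
  _⊕_  : Poly n → Poly n → Poly n
  _⊗_  : Poly n → Poly n → Poly n

eval : {n : ℕ} → Poly n → Vec ℤ n → ℤ
eval (con c) x = c
eval (var i) x = lookup x i
eval (p ⊕ q) x = eval p x + eval q x
eval (p ⊗ q) x = eval p x * eval q x

evalTuple : {n k : ℕ} → Vec (Poly n) k → Vec ℤ n → Vec ℤ k
evalTuple f x = map (λ p → eval p x) f

-- The omitted set L is the zero set of P(y) = ∏_{p ∈ L} ∣y − p∣², and (a, b) ↦ (2a+1)(3b+1)
-- takes every positive value but never the value 0.  Put E = P(y) − (2a+1)(3b+1) and send
-- (a, b, y) to (y₀ + E²(B + y₀²), y₁, …, y_{k−1}).  Where E = 0 this is y, and such a, b exist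
-- exactly when y ∉ L; where E ≠ 0 the first coordinate is at least B, which is chosen larger
-- than the first coordinate of every point of L.
module Submission where

open import Defs
open import Data.Nat using (ℕ; _≤_)
open import Data.Integer using (ℤ)
open import Data.Vec using (Vec)
open import Data.List using (List)
open import Data.List.Membership.Propositional using (_∈_)
open import Data.Product using (Σ; ∃; ∃-syntax)
open import Relation.Nullary using (¬_)
open import Relation.Binary.PropositionalEquality using (_≡_)
open import Function.Bundles using (_⇔_)

open import Data.Nat as ℕ using (zero; suc; NonZero; z≤n; s≤s)
import Data.Nat.Properties as ℕ
open import Data.Nat.Induction using (<-rec)
open import Data.Nat.Divisibility using (0∣⇒≡0)
open import Data.Nat.ListAction using (sum; product)
open import Data.Nat.ListAction.Properties using (∈⇒∣product; product≢0)
open import Data.Integer as ℤ using (+_; -[1+_]; +[1+_]; 0ℤ; 1ℤ; -1ℤ; _+_; _-_; _*_; -_; ∣_∣; +≤+)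
import Data.Integer.Properties as ℤ
open import Data.Integer.Tactic.RingSolver using (solve-∀)
import Data.Fin as Fin
open import Data.Vec using ([]; _∷_; head; tail; tabulate)
import Data.Vec.Properties as Vec
import Data.List as List
open import Data.List using ([]; _∷_)
open import Data.List.Relation.Unary.Any using (here; there)
import Data.List.Relation.Unary.All as All
import Data.List.Relation.Unary.All.Properties as All
open import Data.List.Membership.Propositional.Properties using (∈-map⁺)
open import Data.Product using (_,_; ∃₂)
open import Data.Sum using (inj₁; inj₂; reduce)
open import Data.Empty using (⊥-elim)
open import Function using (_∘_; case_of_)
open import Function.Bundles using (mk⇔; Equivalence)
open import Relation.Nullary using (yes; no)
open import Relation.Binary.PropositionalEquality
  using (_≢_; refl; sym; trans; cong; cong₂; subst; module ≡-Reasoning)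

private
  variable
    m n : ℕ

i*i≡+∣i∣*∣i∣ : ∀ i → i * i ≡ + (∣ i ∣ ℕ.* ∣ i ∣)
i*i≡+∣i∣*∣i∣ (+ m)    = sym (ℤ.pos-* m m)
i*i≡+∣i∣*∣i∣ -[1+ m ] = refl

0≤i*i : ∀ i → 0ℤ ℤ.≤ i * i
0≤i*i i = subst (0ℤ ℤ.≤_) (sym (i*i≡+∣i∣*∣i∣ i)) (+≤+ z≤n)

1≤i*i : ∀ i → i ≢ 0ℤ → 1ℤ ℤ.≤ i * i
1≤i*i (+ zero)   i≢0 = ⊥-elim (i≢0 refl)
1≤i*i +[1+ m ]   _   = +≤+ (s≤s z≤n)
1≤i*i -[1+ m ]   _   = +≤+ (s≤s z≤n)

0≤i+i*i : ∀ i → 0ℤ ℤ.≤ i + i * i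
0≤i+i*i (+ m)    = subst (λ j → 0ℤ ℤ.≤ + m + j) (ℤ.pos-* m m) (+≤+ z≤n)
0≤i+i*i -[1+ m ] =
  subst (0ℤ ℤ.≤_) (sym (ℤ.≤-⊖ (s≤s (ℕ.m≤m+n m (m ℕ.* suc m))))) (+≤+ z≤n)

odd : ℤ → ℤ
odd a = + 2 * a + 1ℤ

oneMod3 : ℤ → ℤ
oneMod3 b = + 3 * b + 1ℤ

[2+d]*q+1≢0 : ∀ d q → + suc (suc d) * q + 1ℤ ≢ 0ℤ
[2+d]*q+1≢0 d q eq = case ℕ.m*n≡1⇒m≡1 (suc (suc d)) ∣ - q ∣ ∣[2+d]*-q∣≡1 of λ ()
  where
  open ≡-Reasoning
  x*-q≡1-[x*q+1] : ∀ x q → x * - q ≡ 1ℤ - (x * q + 1ℤ)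
  x*-q≡1-[x*q+1] = solve-∀
  ∣[2+d]*-q∣≡1 : suc (suc d) ℕ.* ∣ - q ∣ ≡ 1
  ∣[2+d]*-q∣≡1 = begin
    suc (suc d) ℕ.* ∣ - q ∣            ≡⟨ ℤ.abs-* (+ suc (suc d)) (- q) ⟨
    ∣ + suc (suc d) * - q ∣            ≡⟨ cong ∣_∣ (x*-q≡1-[x*q+1] (+ suc (suc d)) q) ⟩
    ∣ 1ℤ - (+ suc (suc d) * q + 1ℤ) ∣  ≡⟨ cong (λ j → ∣ 1ℤ - j ∣) eq ⟩
    1                                  ∎

odd*oneMod3≢0 : ∀ a b → odd a * oneMod3 b ≢ 0ℤ
odd*oneMod3≢0 a b eq with ℤ.i*j≡0⇒i≡0∨j≡0 (odd a) eq
... | inj₁ odd≡0     = [2+d]*q+1≢0 0 a odd≡0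
... | inj₂ oneMod3≡0 = [2+d]*q+1≢0 1 b oneMod3≡0

data Halving : ℕ → Set where
  twice   : ∀ q → Halving (q ℕ.+ q)
  twice+1 : ∀ q → Halving (suc (q ℕ.+ q))

halve : ∀ n → Halving n
halve zero = twice 0
halve (suc n) with halve n
... | twice q   = twice+1 q
... | twice+1 q = subst Halving (cong suc (ℕ.+-suc q q)) (twice (suc q))

-- Odd values are (2q+1)(3·0+1), and (−(2a+1))(−2(3b+1)) = 2(2a+1)(3b+1) handles even ones.
odd*oneMod3-onto-positive : ∀ n → ∃₂ λ a b → odd a * oneMod3 b ≡ + suc n
odd*oneMod3-onto-positive = <-rec _ step
  where
  odd-case : ∀ a → (+ 2 * a + 1ℤ) * (+ 3 * 0ℤ + 1ℤ) ≡ 1ℤ + (a + a)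
  odd-case = solve-∀
  double : ∀ a b → (+ 2 * (- a - 1ℤ) + 1ℤ) * (+ 3 * (- (+ 2 * b) - 1ℤ) + 1ℤ)
                   ≡ (+ 2 * a + 1ℤ) * (+ 3 * b + 1ℤ) + (+ 2 * a + 1ℤ) * (+ 3 * b + 1ℤ)
  double = solve-∀
  step : ∀ n → (∀ {q} → q ℕ.< n → ∃₂ λ a b → odd a * oneMod3 b ≡ + suc q) →
         ∃₂ λ a b → odd a * oneMod3 b ≡ + suc n
  step n rec with halve n
  ... | twice q = + q , 0ℤ , odd-case (+ q)
  ... | twice+1 q with rec {q} (s≤s (ℕ.m≤m+n q q))
  ...   | a , b , eq = - a - 1ℤ , - (+ 2 * b) - 1ℤ , (begin
    odd (- a - 1ℤ) * oneMod3 (- (+ 2 * b) - 1ℤ)  ≡⟨ double a b ⟩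
    odd a * oneMod3 b + odd a * oneMod3 b        ≡⟨ cong₂ _+_ eq eq ⟩
    + (suc q ℕ.+ suc q)                          ≡⟨ cong (+_ ∘ suc) (ℕ.+-suc q q) ⟩
    + suc (suc (q ℕ.+ q))                        ∎)
    where open ≡-Reasoning

sqDist : Vec ℤ m → Vec ℤ m → ℕ
sqDist []      []       = 0
sqDist (c ∷ p) (y ∷ ys) = ∣ y - c ∣ ℕ.* ∣ y - c ∣ ℕ.+ sqDist p ys

sqDist-self : ∀ (y : Vec ℤ m) → sqDist y y ≡ 0
sqDist-self []       = refl
sqDist-self (y ∷ ys) rewrite ℤ.+-inverseʳ y = sqDist-self ys

sqDist≡0⇒≡ : ∀ (p y : Vec ℤ m) → sqDist p y ≡ 0 → p ≡ y
sqDist≡0⇒≡ []      []       _  = refl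
sqDist≡0⇒≡ (c ∷ p) (y ∷ ys) eq = cong₂ _∷_ (sym y≡c) (sqDist≡0⇒≡ p ys (ℕ.m+n≡0⇒n≡0 _ eq))
  where
  ∣y-c∣≡0 : ∣ y - c ∣ ≡ 0
  ∣y-c∣≡0 = reduce (ℕ.m*n≡0⇒m≡0∨n≡0 _ (ℕ.m+n≡0⇒m≡0 _ eq))
  y≡c : y ≡ c
  y≡c = ℤ.i-j≡0⇒i≡j y c (ℤ.∣i∣≡0⇒i≡0 ∣y-c∣≡0)

vanishing : List (Vec ℤ m) → Vec ℤ m → ℕ
vanishing L y = product (List.map (λ p → sqDist p y) L)

∈⇒vanishing≡0 : ∀ (L : List (Vec ℤ m)) y → y ∈ L → vanishing L y ≡ 0
∈⇒vanishing≡0 L y y∈L = 0∣⇒≡0 (∈⇒∣product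
  (subst (_∈ List.map (λ p → sqDist p y) L) (sqDist-self y) (∈-map⁺ (λ p → sqDist p y) y∈L)))

∉⇒vanishing≢0 : ∀ (L : List (Vec ℤ m)) y → ¬ y ∈ L → NonZero (vanishing L y)
∉⇒vanishing≢0 L y y∉L =
  product≢0 (All.map⁺ (All.map sqDist≢0 (All.¬Any⇒All¬ L y∉L)))
  where
  sqDist≢0 : ∀ {p} → y ≢ p → NonZero (sqDist p y)
  sqDist≢0 {p} y≢p = ℕ.≢-nonZero (y≢p ∘ sym ∘ sqDist≡0⇒≡ p y)

sqDistPoly : Vec ℤ m → Vec (Poly n) m → Poly n
sqDistPoly []      []       = con 0ℤ
sqDistPoly (c ∷ p) (q ∷ qs) = ((q ⊕ con (- c)) ⊗ (q ⊕ con (- c))) ⊕ sqDistPoly p qs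

eval-sqDistPoly : ∀ (p : Vec ℤ m) (qs : Vec (Poly n) m) x →
                  eval (sqDistPoly p qs) x ≡ + sqDist p (evalTuple qs x)
eval-sqDistPoly []      []       x = refl
eval-sqDistPoly (c ∷ p) (q ∷ qs) x =
  cong₂ _+_ (i*i≡+∣i∣*∣i∣ (eval q x - c)) (eval-sqDistPoly p qs x)

vanishingPoly : List (Vec ℤ m) → Vec (Poly n) m → Poly n
vanishingPoly []      qs = con 1ℤ
vanishingPoly (p ∷ L) qs = sqDistPoly p qs ⊗ vanishingPoly L qs

eval-vanishingPoly : ∀ (L : List (Vec ℤ m)) (qs : Vec (Poly n) m) x →
                     eval (vanishingPoly L qs) x ≡ + vanishing L (evalTuple qs x)
eval-vanishingPoly []      qs x = refl
eval-vanishingPoly (p ∷ L) qs x =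
  trans (cong₂ _*_ (eval-sqDistPoly p qs x) (eval-vanishingPoly L qs x))
        (sym (ℤ.pos-* (sqDist p y) (vanishing L y)))
  where
  y : Vec ℤ _
  y = evalTuple qs x

headBound : List (Vec ℤ (suc m)) → ℕ
headBound L = sum (List.map (∣_∣ ∘ head) L)

i≤+∣i∣ : ∀ i → i ℤ.≤ + ∣ i ∣
i≤+∣i∣ (+ m)    = ℤ.≤-refl
i≤+∣i∣ -[1+ m ] = ℤ.-≤+

∈⇒head≤headBound : ∀ (L : List (Vec ℤ (suc m))) w → w ∈ L → head w ℤ.≤ + headBound L
∈⇒head≤headBound L w w∈L = ℤ.≤-trans (i≤+∣i∣ (head w)) (+≤+ (∣head∣≤ L w∈L))
  where
  ∣head∣≤ : ∀ L → w ∈ L → ∣ head w ∣ ℕ.≤ headBound L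
  ∣head∣≤ (p ∷ L) (here refl) = ℕ.m≤m+n _ _
  ∣head∣≤ (p ∷ L) (there w∈L) = ℕ.≤-trans (∣head∣≤ L w∈L) (ℕ.m≤n+m _ _)

+B≤z+e*e*[B+z*z] : ∀ B z e → e ≢ 0ℤ → + B ℤ.≤ z + e * e * (+ B + z * z)
+B≤z+e*e*[B+z*z] B z e e≢0 = begin
  + B                  ≡⟨ ℤ.+-identityʳ (+ B) ⟨
  + B + 0ℤ             ≤⟨ ℤ.+-monoʳ-≤ (+ B) (0≤i+i*i z) ⟩
  + B + (z + z * z)    ≡⟨ rearrange (+ B) z ⟩
  z + 1ℤ * W           ≤⟨ ℤ.+-monoʳ-≤ z (ℤ.*-monoʳ-≤-nonNeg W {{ℤ.nonNegative 0≤W}} (1≤i*i e e≢0)) ⟩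
  z + e * e * W        ∎
  where
  open ℤ.≤-Reasoning
  W : ℤ
  W = + B + z * z
  0≤W : 0ℤ ℤ.≤ W
  0≤W = ℤ.+-mono-≤ (+≤+ z≤n) (0≤i*i z)
  rearrange : ∀ b z → b + (z + z * z) ≡ z + 1ℤ * (b + z * z)
  rearrange = solve-∀

module Construction {k : ℕ} (L : List (Vec ℤ (suc k))) where

  point : Vec (Poly (2 ℕ.+ suc k)) (suc k)
  point = tabulate (var ∘ Fin.suc ∘ Fin.suc)

  evalTuple-point : ∀ a b y → evalTuple point (a ∷ b ∷ y) ≡ y
  evalTuple-point a b y =
    trans (sym (Vec.tabulate-∘ (λ p → eval p (a ∷ b ∷ y)) (var ∘ Fin.suc ∘ Fin.suc)))
          (Vec.tabulate∘lookup y)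

  odd*oneMod3Poly : Poly (2 ℕ.+ suc k)
  odd*oneMod3Poly = ((con (+ 2) ⊗ var Fin.zero) ⊕ con 1ℤ)
                  ⊗ ((con (+ 3) ⊗ var (Fin.suc Fin.zero)) ⊕ con 1ℤ)

  defect : Poly (2 ℕ.+ suc k)
  defect = vanishingPoly L point ⊕ (con -1ℤ ⊗ odd*oneMod3Poly)

  eval-defect : ∀ a b y → eval defect (a ∷ b ∷ y) ≡ + vanishing L y - odd a * oneMod3 b
  eval-defect a b y = cong₂ _+_
    (trans (eval-vanishingPoly L point (a ∷ b ∷ y)) (cong (+_ ∘ vanishing L) (evalTuple-point a b y)))
    (ℤ.-1*i≡-i (odd a * oneMod3 b))

  B : ℕ
  B = suc (headBound L)

  f : Vec (Poly (2 ℕ.+ suc k)) (suc k)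
  f = (z ⊕ ((defect ⊗ defect) ⊗ (con (+ B) ⊕ (z ⊗ z)))) ∷ tail point
    where
    z : Poly (2 ℕ.+ suc k)
    z = head point

  defect≡0⇒evalTuple-f : ∀ a b z ys → eval defect (a ∷ b ∷ z ∷ ys) ≡ 0ℤ →
                         evalTuple f (a ∷ b ∷ z ∷ ys) ≡ z ∷ ys
  defect≡0⇒evalTuple-f a b z ys e≡0 = cong₂ _∷_
    (trans (cong (λ e → z + e * e * (+ B + z * z)) e≡0) (ℤ.+-identityʳ z))
    (cong tail (evalTuple-point a b (z ∷ ys)))

  ∉⇒image : ∀ y → ¬ y ∈ L → ∃[ x ] evalTuple f x ≡ y
  ∉⇒image (z ∷ ys) y∉L with odd*oneMod3-onto-positive (ℕ.pred (vanishing L (z ∷ ys)))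
  ... | a , b , eq = a ∷ b ∷ z ∷ ys , defect≡0⇒evalTuple-f a b z ys (begin
    eval defect (a ∷ b ∷ z ∷ ys)  ≡⟨ eval-defect a b (z ∷ ys) ⟩
    + v - odd a * oneMod3 b       ≡⟨ cong (λ j → + v - j) eq ⟩
    + v - + suc (ℕ.pred v)        ≡⟨ cong (λ j → + v - + j) suc[pred[v]]≡v ⟩
    + v - + v                     ≡⟨ ℤ.+-inverseʳ (+ v) ⟩
    0ℤ                            ∎)
    where
    open ≡-Reasoning
    v : ℕ
    v = vanishing L (z ∷ ys)
    suc[pred[v]]≡v : suc (ℕ.pred v) ≡ v
    suc[pred[v]]≡v = ℕ.suc-pred v {{∉⇒vanishing≢0 L (z ∷ ys) y∉L}}

  image⇒∉ : ∀ x y → evalTuple f x ≡ y → ¬ y ∈ L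
  image⇒∉ (a ∷ b ∷ z ∷ ys) _ refl fx∈L with eval defect (a ∷ b ∷ z ∷ ys) ℤ.≟ 0ℤ
  ... | yes e≡0 = odd*oneMod3≢0 a b (begin
    odd a * oneMod3 b       ≡⟨ ℤ.i-j≡0⇒i≡j _ _ (trans (sym (eval-defect a b (z ∷ ys))) e≡0) ⟨
    + vanishing L (z ∷ ys)  ≡⟨ cong +_ (∈⇒vanishing≡0 L (z ∷ ys) y∈L) ⟩
    0ℤ                      ∎)
    where
    open ≡-Reasoning
    y∈L : z ∷ ys ∈ L
    y∈L = subst (_∈ L) (defect≡0⇒evalTuple-f a b z ys e≡0) fx∈L
  ... | no e≢0 = ℕ.<-irrefl refl (ℤ.drop‿+≤+ (ℤ.≤-trans
    (+B≤z+e*e*[B+z*z] B z _ e≢0)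
    (∈⇒head≤headBound L _ fx∈L)))

mainTheorem5 : (k : ℕ) → 1 ≤ k →
    (S : Vec ℤ k → Set) →
    (L : List (Vec ℤ k)) → (∀ y → S y ⇔ (¬ (y ∈ L))) →
    ∃[ n ] Σ (Vec (Poly n) k) (λ f →
      ∀ y → S y ⇔ (∃[ x ] evalTuple f x ≡ y))
mainTheorem5 (suc k) _ S L S⇔∉L = 2 ℕ.+ suc k , f , λ y → mk⇔
  (∉⇒image y ∘ Equivalence.to (S⇔∉L y))
  (λ (x , fx≡y) → Equivalence.from (S⇔∉L y) (image⇒∉ x y fx≡y))
  where open Construction L
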